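{- Let $B$ be an $\mathcal{R}$-base and $v\in V(B)$ a vertex of degree $3$ in $B$. Then there exists a pair $e\in\binom{V(B)}{2}\setminus B$ with $v\notin e$ such that the fundamental $\mathcal{R}$-circuit of $B+e$ contains $v$.
   Context: Graphs are identified with their edge sets. $\mathcal{R}$-independence: a graph $G$ is $\mathcal{R}$-independent iff every set of $m\ge2$ of its vertices induces at most $2m-3$ edges; an $\mathcal{R}$-circuit is a minimal $\mathcal{R}$-dependent graph. $G$ is an $\mathcal{R}$-base if $|G|=2v(G)-3$ and every set of $2\le m<v(G)$ vertices induces at most $2m-3$ edges. For an $\mathcal{R}$-independent $B$ and $e\notin B$ with $B+e$ dependent, the fundamental $\mathcal{R}$-circuit of $B+e$ is the unique $\mathcal{R}$-circuit contained in $B+e$. -}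

module Defs where

open import Data.Nat using (ℕ; _+_; _*_; _≤_; _<_)
open import Data.Bool using (Bool; true; false; _∧_; _∨_; if_then_else_)
open import Data.Fin using (Fin; toℕ; _≟_)
open import Data.Fin.Subset using (Subset; _∈_; ∣_∣)
open import Data.List using (List; length; filterᵇ; concatMap; map)
open import Data.Bool.ListAction using (any)
open import Data.List using (allFin)
open import Data.Vec using (tabulate)
open import Data.Product using (Σ; ∃; _×_; _,_)
open import Data.Nat using (_<ᵇ_)
open import Relation.Nullary using (¬_)
open import Relation.Nullary.Decidable using (⌊_⌋)
open import Relation.Binary.PropositionalEquality using (_≡_)

-- A graph (edge set) on the ambient vertex set Fin n, given by its adjacency
-- function.  Edges are unordered pairs: we require symmetry and no loops.
Graph : ℕ → Set
Graph n = Fin n → Fin n → Bool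

Simple : ∀ {n} → Graph n → Set
Simple {n} G = (∀ (i j : Fin n) → G i j ≡ G j i) × (∀ (i : Fin n) → G i i ≡ false)

_⊆ᴱ_ : ∀ {n} → Graph n → Graph n → Set
_⊆ᴱ_ {n} H G = ∀ (i j : Fin n) → H i j ≡ true → G i j ≡ true

_⊂ᴱ_ : ∀ {n} → Graph n → Graph n → Set
_⊂ᴱ_ {n} H G = H ⊆ᴱ G × Σ (Fin n) λ i → Σ (Fin n) λ j → (G i j ≡ true) × (H i j ≡ false)

-- V(G): vertices incident with at least one edge of G
IsVertex : ∀ {n} → Graph n → Fin n → Set
IsVertex {n} G i = Σ (Fin n) λ j → G i j ≡ true

vertexSet : ∀ {n} → Graph n → Subset n
vertexSet {n} G = tabulate λ i → any (G i) (allFin n)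

numVertices : ∀ {n} → Graph n → ℕ
numVertices G = ∣ vertexSet G ∣

pairs : ∀ n → List (Fin n × Fin n)
pairs n = concatMap (λ i → filterᵇ (λ p → toℕ (Data.Product.proj₁ p) <ᵇ toℕ (Data.Product.proj₂ p))
                                   (map (λ j → (i , j)) (allFin n)))
                    (allFin n)

memᵇ : ∀ {n} → Fin n → Subset n → Bool
memᵇ i S = Data.Vec.lookup S i

induced : ∀ {n} → Graph n → Subset n → ℕ
induced {n} G S =
  length (filterᵇ (λ p → memᵇ (Data.Product.proj₁ p) S ∧ memᵇ (Data.Product.proj₂ p) S
                          ∧ G (Data.Product.proj₁ p) (Data.Product.proj₂ p))
                  (pairs n))

numEdges : ∀ {n} → Graph n → ℕ
numEdges {n} G = length (filterᵇ (λ p → G (Data.Product.proj₁ p) (Data.Product.proj₂ p)) (pairs n))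

_⊆V_ : ∀ {n} → Subset n → Graph n → Set
_⊆V_ {n} S G = ∀ (i : Fin n) → i ∈ S → IsVertex G i

RIndependent : ∀ {n} → Graph n → Set
RIndependent {n} G = ∀ (S : Subset n) → S ⊆V G → 2 ≤ ∣ S ∣ → induced G S + 3 ≤ 2 * ∣ S ∣

RDependent : ∀ {n} → Graph n → Set
RDependent G = ¬ RIndependent G

RCircuit : ∀ {n} → Graph n → Set
RCircuit {n} C = RDependent C × (∀ (C' : Graph n) → Simple C' → C' ⊂ᴱ C → RIndependent C')

RBase : ∀ {n} → Graph n → Set
RBase {n} B =
  (numEdges B + 3 ≡ 2 * numVertices B) ×
  (∀ (S : Subset n) → S ⊆V B → 2 ≤ ∣ S ∣ → ∣ S ∣ < numVertices B → induced B S + 3 ≤ 2 * ∣ S ∣)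

degree : ∀ {n} → Graph n → Fin n → ℕ
degree {n} G v = length (filterᵇ (G v) (allFin n))

addEdge : ∀ {n} → Graph n → Fin n → Fin n → Graph n
addEdge G a b i j =
  G i j ∨ ((⌊ i ≟ a ⌋ ∧ ⌊ j ≟ b ⌋) ∨ (⌊ i ≟ b ⌋ ∧ ⌊ j ≟ a ⌋))

-- C is the fundamental R-circuit of B + e (an R-circuit contained in B + e;
-- it is unique when B is R-independent and B + e is R-dependent)
FundamentalCircuit : ∀ {n} → Graph n → Fin n → Fin n → Graph n → Set
FundamentalCircuit B a b C = Simple C × C ⊆ᴱ addEdge B a b × RCircuit C

{-# OPTIONS --safe #-}
-- Call S ⊆ V(B) tight if it induces 2∣S∣ - 3 edges, the most sparsity allows. The deficiency
-- 2∣S∣ - i(S) is submodular, so tight sets sharing two vertices have a tight union. If each pair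
-- of three neighbours x, y, z of v lay in a tight set avoiding v, gluing these sets (or adding z
-- to one of them when z is adjacent to x and y) would give a tight set W ∌ v containing x, y, z;
-- but W + v has one vertex and three edges more than W, which breaks sparsity. So some pair a, b
-- of neighbours of v lies in no tight set avoiding v. Then ab is not an edge, v lies in every
-- tight set containing a and b, and for a minimum such set X the graph (B + ab)[X] is the
-- fundamental circuit of B + ab: on X it has one edge too many, while on a smaller vertex set
-- (not tight, by minimality) or after deleting an edge it is sparse. Every vertex of X, v
-- included, has a neighbour in X.
module Submission where

open import Data.Bool using (Bool; true; false; _∧_; _∨_; T?)
import Data.Bool as Bool
open import Data.Bool.Properties
  using (T-≡; ¬-not; ∨-zeroʳ; ∨-comm; ∧-comm; ∧-assoc; ∧-zeroʳ; ∧-identityʳ; ∧-conicalˡ; ∧-conicalʳ)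
open import Data.Fin using (Fin; toℕ; _≟_)
import Data.Fin.Properties as Fin
open import Data.Fin.Subset using (Subset; _∈_; _∉_; _⊆_; _∪_; _∩_; _-_; ⁅_⁆; ⊥; ∣_∣; Empty)
open import Data.Fin.Subset.Properties
  using ( _∈?_; anySubset?; ⊆-refl; p⊆p∪q; q⊆p∪q; x∈p∪q⁻; p∩q⊆p; x∈p∩q⁺; x∈p∩q⁻; x∈⁅x⁆; x∈⁅y⁆⇒x≡y
        ; x≢y⇒x∉⁅y⁆; p─q⊆p; x∈p∧x≢y⇒x∈p-y; Empty-unique; ∣⁅x⁆∣≡1; ∣⊥∣≡0; p⊆q⇒∣p∣≤∣q∣; p⊂q⇒∣p∣<∣q∣
        ; ∣p∩q∣≤∣p∣; ∣p∣≤∣p∪q∣; x∈p⇒∣p-x∣<∣p∣ )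
open import Data.List using (List; []; _∷_; length; filterᵇ; map; allFin)
open import Data.List.Membership.Propositional using () renaming (_∈_ to _∈ˡ_; _∉_ to _∉ˡ_)
open import Data.List.Membership.Propositional.Properties
  using (∈-concatMap⁺; ∈-concatMap⁻; ∈-filter⁺; ∈-filter⁻; ∈-map⁺; ∈-map⁻; ∈-allFin)
open import Data.List.Relation.Binary.Disjoint.Propositional using (Disjoint)
open import Data.List.Relation.Unary.All as All using (All; []; _∷_)
import Data.List.Relation.Unary.All.Properties as All
open import Data.List.Relation.Unary.AllPairs as AllPairs using ([]; _∷_)
import Data.List.Relation.Unary.AllPairs.Properties as AllPairs
open import Data.List.Relation.Unary.Any using (here; there; satisfied)
open import Data.List.Relation.Unary.Any.Properties using (tabulate⁺; any⁺; any⁻)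
open import Data.List.Relation.Unary.Unique.Propositional using (Unique)
import Data.List.Relation.Unary.Unique.Propositional.Properties as Unique
open import Data.Nat using (ℕ; suc; _+_; _*_; _≤_; _<_; _<ᵇ_; _≤?_; _<?_; s≤s; z≤n)
import Data.Nat as ℕ
open import Data.Nat.Induction using (<-wellFounded)
open import Data.Nat.Properties
  using ( module ≤-Reasoning; ≤-reflexive; ≤-trans; ≤-antisym; <-irrefl; ≮⇒≥; <⇒≱; ≤∧≢⇒<; m≤n⇒m≤1+n
        ; m≤n+m; m+n≤o⇒m≤o; m+1+n≰m; +-assoc; +-comm; +-suc; +-identityʳ; +-mono-≤; +-monoˡ-≤
        ; +-monoʳ-≤; +-cancelʳ-≤; *-distribˡ-+; *-monoʳ-≤; *-monoʳ-<; <⇒<ᵇ; <ᵇ⇒<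
        ; +-commutativeSemigroup )
open import Algebra.Properties.CommutativeSemigroup +-commutativeSemigroup using (interchange; xy∙z≈xz∙y)
open import Data.Nat.Tactic.RingSolver using (solve-∀)
open import Data.Product using (Σ; _×_; _,_; proj₁; proj₂; uncurry; ∃-syntax)
open import Data.Sum using (_⊎_; inj₁; inj₂; [_,_])
open import Data.Vec using ([]; _∷_)
open import Data.Vec.Properties using ([]=⇒lookup; lookup⇒[]=; lookup∘tabulate)
open import Function using (_∘_; id; case_of_; Equivalence)
open import Induction.WellFounded using (Acc; acc)
open import Relation.Binary.Definitions using (tri<; tri≈; tri>)
open import Relation.Binary.PropositionalEquality
  using (_≡_; _≢_; refl; sym; trans; cong; cong₂; subst; ≢-sym; module ≡-Reasoning)
open import Relation.Nullary using (¬_; ¬?; Dec; yes; no; contradiction; _×-dec_; _→-dec_)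
open import Relation.Nullary.Decidable using (⌊_⌋; decidable-stable)

open import Defs

count : ∀ {A : Set} → (A → Bool) → List A → ℕ
count p xs = length (filterᵇ p xs)

module _ {A : Set} where

  count-mono : ∀ {p q : A → Bool} → (∀ x → p x ≡ true → q x ≡ true) →
               ∀ xs → count p xs ≤ count q xs
  count-mono p⇒q [] = z≤n
  count-mono {p} {q} p⇒q (x ∷ xs) with p x in px | q x in qx
  ... | true  | true  = s≤s (count-mono p⇒q xs)
  ... | true  | false = contradiction (trans (sym qx) (p⇒q x px)) λ ()
  ... | false | true  = m≤n⇒m≤1+n (count-mono p⇒q xs)
  ... | false | false = count-mono p⇒q xs

  count-none : ∀ {p : A → Bool} xs → (∀ {x} → x ∈ˡ xs → p x ≡ false) → count p xs ≡ 0
  count-none [] _ = refl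
  count-none {p} (x ∷ xs) none with p x | none (here refl)
  ... | false | _ = count-none xs (none ∘ there)

  count-∨-∧ : ∀ (p q : A → Bool) xs →
              count (λ x → p x ∨ q x) xs + count (λ x → p x ∧ q x) xs ≡ count p xs + count q xs
  count-∨-∧ p q [] = refl
  count-∨-∧ p q (x ∷ xs) with p x | q x | count-∨-∧ p q xs
  ... | true  | true  | eq = cong suc (trans (+-suc _ _) (trans (cong suc eq) (sym (+-suc _ _))))
  ... | true  | false | eq = cong suc eq
  ... | false | true  | eq = trans (cong suc eq) (sym (+-suc _ _))
  ... | false | false | eq = eq

  count-∨-≤ : ∀ (p q : A → Bool) xs → count (λ x → p x ∨ q x) xs ≤ count p xs + count q xs
  count-∨-≤ p q xs = m+n≤o⇒m≤o _ (≤-reflexive (count-∨-∧ p q xs))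

  count-∨-disjoint : ∀ (p q : A → Bool) xs → (∀ x → p x ∧ q x ≡ false) →
                     count (λ x → p x ∨ q x) xs ≡ count p xs + count q xs
  count-∨-disjoint p q xs disjoint = begin
    count p∨q xs                    ≡⟨ +-identityʳ _ ⟨
    count p∨q xs + 0                ≡⟨ cong (count p∨q xs +_) (count-none xs λ {x} _ → disjoint x) ⟨
    count p∨q xs + count p∧q xs     ≡⟨ count-∨-∧ p q xs ⟩
    count p xs + count q xs         ∎
    where
    open ≡-Reasoning
    p∨q p∧q : A → Bool
    p∨q x = p x ∨ q x
    p∧q x = p x ∧ q x

  count-unique : ∀ {p : A → Bool} {x xs} → Unique xs → x ∈ˡ xs → p x ≡ true →
                 (∀ {y} → y ∈ˡ xs → p y ≡ true → y ≡ x) → count p xs ≡ 1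
  count-unique {p} {xs = _ ∷ ys} (x∉ys ∷ _) (here refl) px only rewrite px =
    cong suc (count-none ys others)
    where
    others : ∀ {z} → z ∈ˡ ys → p z ≡ false
    others {z} z∈ys with p z in pz
    ... | true  = contradiction (sym (only (there z∈ys) pz)) (All.lookup x∉ys z∈ys)
    ... | false = refl
  count-unique {p} {xs = y ∷ ys} (y∉ys ∷ ys!) (there x∈ys) px only with p y in py
  ... | true  = contradiction (only (here refl) py) (All.lookup y∉ys x∈ys)
  ... | false = count-unique ys! x∈ys px (only ∘ there)

module _ {n : ℕ} where

  private
    ordered : Fin n × Fin n → Bool
    ordered p = toℕ (proj₁ p) <ᵇ toℕ (proj₂ p)

    row : Fin n → List (Fin n × Fin n)
    row i = filterᵇ ordered (map (i ,_) (allFin n))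

    ∈-row⇒proj₁≡ : ∀ {i p} → p ∈ˡ row i → proj₁ p ≡ i
    ∈-row⇒proj₁≡ {i} p∈
      with _ , _ , refl ← ∈-map⁻ (i ,_) {xs = allFin n}
                            (proj₁ (∈-filter⁻ (T? ∘ ordered) {xs = map (i ,_) (allFin n)} p∈))
      = refl

  ∈-pairs⁺ : ∀ {i j : Fin n} → toℕ i < toℕ j → (i , j) ∈ˡ pairs n
  ∈-pairs⁺ {i} {j} i<j =
    ∈-concatMap⁺ row (tabulate⁺ i (∈-filter⁺ (T? ∘ ordered) (∈-map⁺ (i ,_) (∈-allFin j)) (<⇒<ᵇ i<j)))

  ∈-pairs⁻ : ∀ {i j : Fin n} → (i , j) ∈ˡ pairs n → toℕ i < toℕ j
  ∈-pairs⁻ {i} {j} p∈ with k , p∈row ← satisfied (∈-concatMap⁻ row {xs = allFin n} p∈) =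
    <ᵇ⇒< (toℕ i) (toℕ j) (proj₂ (∈-filter⁻ (T? ∘ ordered) {xs = map (k ,_) (allFin n)} p∈row))

  pairs-unique : Unique (pairs n)
  pairs-unique = Unique.concat⁺ (All.map⁺ (All.universal row-unique (allFin n)))
                                (AllPairs.map⁺ (AllPairs.map rows-disjoint (Unique.allFin⁺ n)))
    where
    row-unique : ∀ i → Unique (row i)
    row-unique i = Unique.filter⁺ (T? ∘ ordered) (Unique.map⁺ (cong proj₂) (Unique.allFin⁺ n))
    rows-disjoint : ∀ {i i′} → i ≢ i′ → Disjoint (row i) (row i′)
    rows-disjoint i≢i′ (p∈ , p∈′) = i≢i′ (trans (sym (∈-row⇒proj₁≡ p∈)) (∈-row⇒proj₁≡ p∈′))

-- Edge counts

module _ {n : ℕ} where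

  infixr 25 _∪ᴳ_ _∩ᴳ_

  ∅ᴳ : Graph n
  ∅ᴳ _ _ = false

  _∪ᴳ_ _∩ᴳ_ : Graph n → Graph n → Graph n
  (G ∪ᴳ H) i j = G i j ∨ H i j
  (G ∩ᴳ H) i j = G i j ∧ H i j

  edge : Fin n → Fin n → Graph n
  edge = addEdge ∅ᴳ

  edge⁺ : ∀ a b → edge a b a b ≡ true
  edge⁺ a b with a ≟ a | b ≟ b
  ... | yes _  | yes _  = refl
  ... | no a≢a | _      = contradiction refl a≢a
  ... | yes _  | no b≢b = contradiction refl b≢b

  edge⁻ : ∀ {a b i j} → edge a b i j ≡ true → (i ≡ a × j ≡ b) ⊎ (i ≡ b × j ≡ a)
  edge⁻ {a} {b} {i} {j} e with i ≟ a | j ≟ b | i ≟ b | j ≟ a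
  ... | yes i≡a | yes j≡b | _       | _       = inj₁ (i≡a , j≡b)
  ... | _       | _       | yes i≡b | yes j≡a = inj₂ (i≡b , j≡a)
  ... | no _    | _       | no _    | _       = contradiction e λ ()
  ... | no _    | _       | yes _   | no _    = contradiction e λ ()
  ... | yes _   | no _    | no _    | _       = contradiction e λ ()
  ... | yes _   | no _    | yes _   | no _    = contradiction e λ ()

  edge-sym : ∀ a b i j → edge a b i j ≡ edge a b j i
  edge-sym a b i j =
    trans (∨-comm (⌊ i ≟ a ⌋ ∧ ⌊ j ≟ b ⌋) _) (cong₂ _∨_ (∧-comm ⌊ i ≟ b ⌋ _) (∧-comm ⌊ i ≟ a ⌋ _))

  addEdge-⊇ : ∀ (G : Graph n) a b → G ⊆ᴱ addEdge G a b
  addEdge-⊇ G a b i j Gij rewrite Gij = refl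

  addEdge-new : ∀ (G : Graph n) a b → addEdge G a b a b ≡ true
  addEdge-new G a b = trans (cong (G a b ∨_) (edge⁺ a b)) (∨-zeroʳ (G a b))

  addEdge-simple : ∀ {G : Graph n} {a b} → Simple G → a ≢ b → Simple (addEdge G a b)
  addEdge-simple {G} {a} {b} (sym-G , irrefl-G) a≢b = sym-A , irrefl-A
    where
    sym-A : ∀ i j → addEdge G a b i j ≡ addEdge G a b j i
    sym-A i j = cong₂ _∨_ (sym-G i j) (edge-sym a b i j)
    irrefl-A : ∀ i → addEdge G a b i i ≡ false
    irrefl-A i rewrite irrefl-G i = ¬-not λ e → case edge⁻ {a = a} {b} {i} {i} e of λ where
      (inj₁ (refl , refl)) → a≢b refl
      (inj₂ (refl , refl)) → a≢b refl

  numEdges-mono : ∀ {G H : Graph n} → G ⊆ᴱ H → numEdges G ≤ numEdges H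
  numEdges-mono G⊆H = count-mono (λ p → G⊆H (proj₁ p) (proj₂ p)) (pairs n)

  numEdges-∪-∩ : ∀ (G H : Graph n) → numEdges (G ∪ᴳ H) + numEdges (G ∩ᴳ H) ≡ numEdges G + numEdges H
  numEdges-∪-∩ G H = count-∨-∧ (uncurry G) (uncurry H) (pairs n)

  numEdges-edge : ∀ {a b} → a ≢ b → numEdges (edge a b) ≡ 1
  numEdges-edge {a} {b} a≢b with Fin.<-cmp a b
  ... | tri< a<b _ _ = count-unique pairs-unique (∈-pairs⁺ a<b) (edge⁺ a b) only
    where
    only : ∀ {p} → p ∈ˡ pairs n → uncurry (edge a b) p ≡ true → p ≡ (a , b)
    only {i , j} p∈ e with edge⁻ {a} {b} {i} {j} e
    ... | inj₁ (refl , refl) = refl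
    ... | inj₂ (refl , refl) = contradiction (∈-pairs⁻ p∈) (Fin.<-asym a<b)
  ... | tri≈ _ a≡b _ = contradiction a≡b a≢b
  ... | tri> _ _ b<a =
    count-unique pairs-unique (∈-pairs⁺ b<a) (trans (edge-sym a b b a) (edge⁺ a b)) only
    where
    only : ∀ {p} → p ∈ˡ pairs n → uncurry (edge a b) p ≡ true → p ≡ (b , a)
    only {i , j} p∈ e with edge⁻ {a} {b} {i} {j} e
    ... | inj₁ (refl , refl) = contradiction (∈-pairs⁻ p∈) (Fin.<-asym b<a)
    ... | inj₂ (refl , refl) = refl

  numEdges-addEdge-≤ : ∀ G {a b} → a ≢ b → numEdges (addEdge G a b) ≤ numEdges G + 1
  numEdges-addEdge-≤ G {a} {b} a≢b = begin
    numEdges (addEdge G a b)          ≤⟨ count-∨-≤ (uncurry G) (uncurry (edge a b)) (pairs n) ⟩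
    numEdges G + numEdges (edge a b)  ≡⟨ cong (numEdges G +_) (numEdges-edge a≢b) ⟩
    numEdges G + 1                    ∎
    where open ≤-Reasoning

  numEdges-addEdge : ∀ G {a b} → a ≢ b → G a b ≡ false → G b a ≡ false →
                     numEdges (addEdge G a b) ≡ numEdges G + 1
  numEdges-addEdge G {a} {b} a≢b Gab Gba = begin
    numEdges (addEdge G a b)
      ≡⟨ count-∨-disjoint (uncurry G) (uncurry (edge a b)) (pairs n) disjoint ⟩
    numEdges G + numEdges (edge a b)  ≡⟨ cong (numEdges G +_) (numEdges-edge a≢b) ⟩
    numEdges G + 1                    ∎
    where
    open ≡-Reasoning
    disjoint : ∀ p → uncurry G p ∧ uncurry (edge a b) p ≡ false
    disjoint (i , j) with edge a b i j in e
    ... | false = ∧-zeroʳ _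
    ... | true with edge⁻ {a} {b} {i} {j} e
    ...   | inj₁ (refl , refl) = trans (∧-identityʳ _) Gab
    ...   | inj₂ (refl , refl) = trans (∧-identityʳ _) Gba

  module _ {G : Graph n} (simple : Simple G) where

    neighbour-vertex : ∀ {v w} → G v w ≡ true → IsVertex G w
    neighbour-vertex {v} {w} Gvw = v , trans (proj₁ simple w v) Gvw

    neighbour-≢ : ∀ {v w} → G v w ≡ true → w ≢ v
    neighbour-≢ {v} Gvw refl = contradiction (trans (sym Gvw) (proj₂ simple v)) λ ()

∣∪∣+∣∩∣ : ∀ {m} (p q : Subset m) → ∣ p ∪ q ∣ + ∣ p ∩ q ∣ ≡ ∣ p ∣ + ∣ q ∣
∣∪∣+∣∩∣ [] [] = refl
∣∪∣+∣∩∣ (x ∷ p) (y ∷ q) with x | y | ∣∪∣+∣∩∣ p q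
... | true  | true  | eq = cong suc (trans (+-suc _ _) (trans (cong suc eq) (sym (+-suc _ _))))
... | true  | false | eq = cong suc eq
... | false | true  | eq = trans (cong suc eq) (sym (+-suc _ _))
... | false | false | eq = eq

module _ {m : ℕ} where

  ∣∪∣≤ : ∀ (p q : Subset m) → ∣ p ∪ q ∣ ≤ ∣ p ∣ + ∣ q ∣
  ∣∪∣≤ p q = m+n≤o⇒m≤o _ (≤-reflexive (∣∪∣+∣∩∣ p q))

  ∣∪⁅⁆∣≤ : ∀ (p : Subset m) i → ∣ p ∪ ⁅ i ⁆ ∣ ≤ ∣ p ∣ + 1
  ∣∪⁅⁆∣≤ p i = ≤-trans (∣∪∣≤ p ⁅ i ⁆) (≤-reflexive (cong (∣ p ∣ +_) (∣⁅x⁆∣≡1 i)))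

  ∈-∪ˡ : ∀ {i : Fin m} {p} q → i ∈ p → i ∈ p ∪ q
  ∈-∪ˡ q = p⊆p∪q q

  ∈-∪ʳ : ∀ {i : Fin m} p {q} → i ∈ q → i ∈ p ∪ q
  ∈-∪ʳ p {q} = q⊆p∪q p q

  ∉-∪ : ∀ {i : Fin m} {p q} → i ∉ p → i ∉ q → i ∉ p ∪ q
  ∉-∪ {p = p} {q} i∉p i∉q = [ i∉p , i∉q ] ∘ x∈p∪q⁻ p q

  ∪-⊆ : ∀ {p q r : Subset m} → p ⊆ r → q ⊆ r → p ∪ q ⊆ r
  ∪-⊆ {p} {q} p⊆r q⊆r = [ p⊆r , q⊆r ] ∘ x∈p∪q⁻ p q

  ⁅⁆-⊆ : ∀ {i : Fin m} {p} → i ∈ p → ⁅ i ⁆ ⊆ p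
  ⁅⁆-⊆ {i} i∈p j∈⁅i⁆ rewrite x∈⁅y⁆⇒x≡y i j∈⁅i⁆ = i∈p

  member⇒1≤∣∣ : ∀ {i : Fin m} {p} → i ∈ p → 1 ≤ ∣ p ∣
  member⇒1≤∣∣ {i} i∈p = subst (_≤ _) (∣⁅x⁆∣≡1 i) (p⊆q⇒∣p∣≤∣q∣ (⁅⁆-⊆ i∈p))

  two-members⇒2≤∣∣ : ∀ {i j : Fin m} {p} → i ≢ j → i ∈ p → j ∈ p → 2 ≤ ∣ p ∣
  two-members⇒2≤∣∣ {i} {j} {p} i≢j i∈p j∈p = begin
    2                                  ≡⟨ cong₂ _+_ (∣⁅x⁆∣≡1 i) (∣⁅x⁆∣≡1 j) ⟨
    ∣ ⁅ i ⁆ ∣ + ∣ ⁅ j ⁆ ∣                ≡⟨ ∣∪∣+∣∩∣ ⁅ i ⁆ ⁅ j ⁆ ⟨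
    ∣ ⁅ i ⁆ ∪ ⁅ j ⁆ ∣ + ∣ ⁅ i ⁆ ∩ ⁅ j ⁆ ∣  ≡⟨ cong (∣ ⁅ i ⁆ ∪ ⁅ j ⁆ ∣ +_) ∣⁅i⁆∩⁅j⁆∣≡0 ⟩
    ∣ ⁅ i ⁆ ∪ ⁅ j ⁆ ∣ + 0                ≡⟨ +-identityʳ _ ⟩
    ∣ ⁅ i ⁆ ∪ ⁅ j ⁆ ∣                    ≤⟨ p⊆q⇒∣p∣≤∣q∣ (∪-⊆ (⁅⁆-⊆ i∈p) (⁅⁆-⊆ j∈p)) ⟩
    ∣ p ∣                              ∎
    where
    open ≤-Reasoning
    disjoint : Empty (⁅ i ⁆ ∩ ⁅ j ⁆)
    disjoint (k , k∈) with k∈⁅i⁆ , k∈⁅j⁆ ← x∈p∩q⁻ ⁅ i ⁆ ⁅ j ⁆ k∈ =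
      i≢j (trans (sym (x∈⁅y⁆⇒x≡y i k∈⁅i⁆)) (x∈⁅y⁆⇒x≡y j k∈⁅j⁆))
    ∣⁅i⁆∩⁅j⁆∣≡0 : ∣ ⁅ i ⁆ ∩ ⁅ j ⁆ ∣ ≡ 0
    ∣⁅i⁆∩⁅j⁆∣≡0 = trans (cong ∣_∣ (Empty-unique disjoint)) (∣⊥∣≡0 m)

  ∣∣<2⇒members-≡ : ∀ {i j : Fin m} {p} → ¬ 2 ≤ ∣ p ∣ → i ∈ p → j ∈ p → i ≡ j
  ∣∣<2⇒members-≡ {i} {j} ∣p∣<2 i∈p j∈p =
    decidable-stable (i ≟ j) (λ i≢j → ∣p∣<2 (two-members⇒2≤∣∣ i≢j i∈p j∈p))

module _ {n : ℕ} {P : Subset n → Set} (P? : ∀ S → Dec (P S)) where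

  minimum-∣∣ : ∀ {S} → P S → ∃[ X ] (P X × ∀ {Y} → P Y → ∣ X ∣ ≤ ∣ Y ∣)
  minimum-∣∣ {S} PS = search S PS (<-wellFounded ∣ S ∣)
    where
    search : ∀ S → P S → Acc _<_ ∣ S ∣ → ∃[ X ] (P X × ∀ {Y} → P Y → ∣ X ∣ ≤ ∣ Y ∣)
    search S PS (acc smaller) with anySubset? (λ Y → P? Y ×-dec (∣ Y ∣ <? ∣ S ∣))
    ... | yes (Y , PY , ∣Y∣<∣S∣) = search Y PY (smaller ∣Y∣<∣S∣)
    ... | no ∄smaller = S , PS , λ PY → ≮⇒≥ λ ∣Y∣<∣S∣ → ∄smaller (_ , PY , ∣Y∣<∣S∣)

-- Induced subgraphs

module _ {n : ℕ} where

  infixl 30 _[_]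

  _[_] : Graph n → Subset n → Graph n
  (G [ S ]) i j = memᵇ i S ∧ memᵇ j S ∧ G i j

  []-edge⁺ : ∀ {G : Graph n} {S i j} → i ∈ S → j ∈ S → G i j ≡ true → (G [ S ]) i j ≡ true
  []-edge⁺ i∈S j∈S Gij rewrite []=⇒lookup i∈S | []=⇒lookup j∈S = Gij

  []-edge⁻ : ∀ {G : Graph n} {S i j} → (G [ S ]) i j ≡ true → i ∈ S × j ∈ S × G i j ≡ true
  []-edge⁻ {S = S} {i} {j} e with memᵇ i S in i∈S | memᵇ j S in j∈S
  ... | true  | true  = lookup⇒[]= i S i∈S , lookup⇒[]= j S j∈S , e
  ... | true  | false = contradiction e λ ()
  ... | false | _     = contradiction e λ ()

  []-mono : ∀ {G H : Graph n} {S T} → G ⊆ᴱ H → S ⊆ T → G [ S ] ⊆ᴱ H [ T ]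
  []-mono {G} {H} {S} {T} G⊆H S⊆T i j e with i∈S , j∈S , Gij ← []-edge⁻ {G = G} {S = S} e =
    []-edge⁺ {G = H} {S = T} (S⊆T i∈S) (S⊆T j∈S) (G⊆H i j Gij)

  []-⊆ᴱ : ∀ {G : Graph n} {S} → G [ S ] ⊆ᴱ G
  []-⊆ᴱ {G} {S} i j e = proj₂ (proj₂ ([]-edge⁻ {G = G} {S = S} e))

  []-non-edge : ∀ {G : Graph n} {S i j} → G i j ≡ false → (G [ S ]) i j ≡ false
  []-non-edge {G} {S} Gij =
    ¬-not λ e → contradiction (trans (sym Gij) (proj₂ (proj₂ ([]-edge⁻ {G = G} {S = S} e)))) λ ()

  []-simple : ∀ {G : Graph n} {S} → Simple G → Simple (G [ S ])
  []-simple {G} {S} (sym-G , irrefl-G) = sym-G[S] , irrefl-G[S]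
    where
    sym-G[S] : ∀ i j → (G [ S ]) i j ≡ (G [ S ]) j i
    sym-G[S] i j rewrite sym-G i j =
      trans (sym (∧-assoc (memᵇ i S) (memᵇ j S) _))
            (trans (cong (_∧ G j i) (∧-comm (memᵇ i S) _)) (∧-assoc (memᵇ j S) (memᵇ i S) _))
    irrefl-G[S] : ∀ i → (G [ S ]) i i ≡ false
    irrefl-G[S] i rewrite irrefl-G i = trans (cong (memᵇ i S ∧_) (∧-zeroʳ _)) (∧-zeroʳ _)

  induced-mono : ∀ {G H : Graph n} {S T} → G ⊆ᴱ H → S ⊆ T → induced G S ≤ induced H T
  induced-mono G⊆H S⊆T = numEdges-mono ([]-mono G⊆H S⊆T)

  induced≤numEdges : ∀ (G : Graph n) S → induced G S ≤ numEdges G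
  induced≤numEdges G S = numEdges-mono ([]-⊆ᴱ {G = G} {S = S})

  induced-[] : ∀ {G : Graph n} {S X} → S ⊆ X → induced (G [ X ]) S ≡ induced G S
  induced-[] {G} {S} {X} S⊆X =
    ≤-antisym (induced-mono {S = S} ([]-⊆ᴱ {G = G} {S = X}) ⊆-refl) (numEdges-mono G[S]⊆G[X][S])
    where
    G[S]⊆G[X][S] : G [ S ] ⊆ᴱ G [ X ] [ S ]
    G[S]⊆G[X][S] i j e with i∈S , j∈S , Gij ← []-edge⁻ {G = G} {S = S} e =
      []-edge⁺ {G = G [ X ]} {S = S} i∈S j∈S ([]-edge⁺ {G = G} {S = X} (S⊆X i∈S) (S⊆X j∈S) Gij)

  induced-edgeless : ∀ {G : Graph n} {S} → (∀ {i j} → i ∈ S → j ∈ S → G i j ≡ false) → induced G S ≡ 0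
  induced-edgeless {G} {S} edgeless = count-none (pairs n) no-edge
    where
    no-edge : ∀ {p} → p ∈ˡ pairs n → uncurry (G [ S ]) p ≡ false
    no-edge {i , j} _ = ¬-not λ e → let i∈S , j∈S , Gij = []-edge⁻ {G = G} {S = S} e in
      contradiction (trans (sym Gij) (edgeless i∈S j∈S)) λ ()

  induced-supermodular : ∀ (G : Graph n) S T →
                         induced G S + induced G T ≤ induced G (S ∪ T) + induced G (S ∩ T)
  induced-supermodular G S T = begin
    induced G S + induced G T
      ≡⟨ numEdges-∪-∩ (G [ S ]) (G [ T ]) ⟨
    numEdges (G [ S ] ∪ᴳ G [ T ]) + numEdges (G [ S ] ∩ᴳ G [ T ])
      ≤⟨ +-mono-≤ (numEdges-mono ∪-edges) (numEdges-mono ∩-edges) ⟩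
    induced G (S ∪ T) + induced G (S ∩ T)
      ∎
    where
    open ≤-Reasoning
    ∪-edges : G [ S ] ∪ᴳ G [ T ] ⊆ᴱ G [ S ∪ T ]
    ∪-edges i j e with (G [ S ]) i j in eS
    ... | true  = []-mono {G = G} {H = G} {S = S} (λ _ _ → id) (p⊆p∪q T) i j eS
    ... | false = []-mono {G = G} {H = G} {S = T} (λ _ _ → id) (q⊆p∪q S T) i j e
    ∩-edges : G [ S ] ∩ᴳ G [ T ] ⊆ᴱ G [ S ∩ T ]
    ∩-edges i j e
      with i∈S , j∈S , Gij ← []-edge⁻ {G = G} {S = S} (∧-conicalˡ ((G [ S ]) i j) _ e)
         | i∈T , j∈T , _   ← []-edge⁻ {G = G} {S = T} (∧-conicalʳ ((G [ S ]) i j) _ e)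
      = []-edge⁺ {G = G} {S = S ∩ T} (x∈p∩q⁺ (i∈S , i∈T)) (x∈p∩q⁺ (j∈S , j∈T)) Gij

  induced-addEdge-≤ : ∀ (G : Graph n) {a b} S → a ≢ b → induced (addEdge G a b) S ≤ induced G S + 1
  induced-addEdge-≤ G {a} {b} S a≢b =
    ≤-trans (numEdges-mono A[S]⊆G[S]+ab) (numEdges-addEdge-≤ (G [ S ]) a≢b)
    where
    A[S]⊆G[S]+ab : addEdge G a b [ S ] ⊆ᴱ addEdge (G [ S ]) a b
    A[S]⊆G[S]+ab i j e with memᵇ i S | memᵇ j S
    ... | true  | true  = e
    ... | true  | false = contradiction e λ ()
    ... | false | _     = contradiction e λ ()

  induced-addEdge-∉ : ∀ (G : Graph n) {a b S} → ¬ (a ∈ S × b ∈ S) →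
                      induced (addEdge G a b) S ≤ induced G S
  induced-addEdge-∉ G {a} {b} {S} ¬a,b∈S = numEdges-mono A[S]⊆G[S]
    where
    A[S]⊆G[S] : addEdge G a b [ S ] ⊆ᴱ G [ S ]
    A[S]⊆G[S] i j e with i∈S , j∈S , Aij ← []-edge⁻ {G = addEdge G a b} {S = S} e | G i j Bool.≟ true
    ... | yes Gij = []-edge⁺ {G = G} {S = S} i∈S j∈S Gij
    ... | no Gij≢true with edge⁻ {a = a} {b} {i} {j} (subst (λ g → g ∨ _ ≡ true) (¬-not Gij≢true) Aij)
    ...   | inj₁ (refl , refl) = contradiction (i∈S , j∈S) ¬a,b∈S
    ...   | inj₂ (refl , refl) = contradiction (j∈S , i∈S) ¬a,b∈S

  induced-⊂ᴱ : ∀ {H G : Graph n} {S i j} → H ⊆ᴱ G → Simple H → Simple G → i ∈ S → j ∈ S →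
               H i j ≡ false → G i j ≡ true → induced H S + 1 ≤ induced G S
  induced-⊂ᴱ {H} {G} {S} {i} {j} H⊆G (sym-H , _) (sym-G , irrefl-G) i∈S j∈S Hij Gij = begin
    induced H S + 1                   ≡⟨ numEdges-addEdge (H [ S ]) i≢j H[S]ij≡false H[S]ji≡false ⟨
    numEdges (addEdge (H [ S ]) i j)  ≤⟨ numEdges-mono H[S]+ij⊆G[S] ⟩
    induced G S                       ∎
    where
    open ≤-Reasoning
    i≢j : i ≢ j
    i≢j refl = contradiction (trans (sym Gij) (irrefl-G i)) λ ()
    H[S]ij≡false : (H [ S ]) i j ≡ false
    H[S]ij≡false = []-non-edge {G = H} {S = S} Hij
    H[S]ji≡false : (H [ S ]) j i ≡ false
    H[S]ji≡false = []-non-edge {G = H} {S = S} (trans (sym-H j i) Hij)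
    H[S]+ij⊆G[S] : addEdge (H [ S ]) i j ⊆ᴱ G [ S ]
    H[S]+ij⊆G[S] k l e with (H [ S ]) k l in H[S]kl
    ... | true = []-mono {G = H} {H = G} {S = S} H⊆G ⊆-refl k l H[S]kl
    ... | false with edge⁻ {a = i} {j} {k} {l} e
    ...   | inj₁ (refl , refl) = []-edge⁺ {G = G} {S = S} i∈S j∈S Gij
    ...   | inj₂ (refl , refl) = []-edge⁺ {G = G} {S = S} j∈S i∈S (trans (sym-G j i) Gij)

  addStar : Graph n → Fin n → List (Fin n) → Graph n
  addStar G w []       = G
  addStar G w (k ∷ ks) = addEdge (addStar G w ks) w k

  addStar⁻ : ∀ {G w} ks {i j} → addStar G w ks i j ≡ true →
             G i j ≡ true ⊎ (i ≡ w × j ∈ˡ ks) ⊎ (j ≡ w × i ∈ˡ ks)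
  addStar⁻ [] e = inj₁ e
  addStar⁻ {G} {w} (k ∷ ks) {i} {j} e with addStar G w ks i j in e′
  ... | true with addStar⁻ ks e′
  ...   | inj₁ Gij               = inj₁ Gij
  ...   | inj₂ (inj₁ (i≡w , j∈)) = inj₂ (inj₁ (i≡w , there j∈))
  ...   | inj₂ (inj₂ (j≡w , i∈)) = inj₂ (inj₂ (j≡w , there i∈))
  addStar⁻ {G} {w} (k ∷ ks) {i} {j} e | false with edge⁻ {a = w} {k} {i} {j} e
  ...   | inj₁ (refl , refl) = inj₂ (inj₁ (refl , here refl))
  ...   | inj₂ (refl , refl) = inj₂ (inj₂ (refl , here refl))

  numEdges-addStar : ∀ {G : Graph n} {S w} ks → w ∉ S → Unique ks → All (_∈ S) ks →
                     numEdges (addStar (G [ S ]) w ks) ≡ induced G S + length ks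
  numEdges-addStar [] _ _ _ = sym (+-identityʳ _)
  numEdges-addStar {G} {S} {w} (k ∷ ks) w∉S (k∉ks ∷ ks!) (k∈S ∷ ks⊆S) = begin
    numEdges (addEdge (addStar (G [ S ]) w ks) w k)
      ≡⟨ numEdges-addEdge _ w≢k (¬-not no-wk) (¬-not no-kw) ⟩
    numEdges (addStar (G [ S ]) w ks) + 1           ≡⟨ cong (_+ 1) (numEdges-addStar ks w∉S ks! ks⊆S) ⟩
    induced G S + length ks + 1                     ≡⟨ +-assoc (induced G S) (length ks) 1 ⟩
    induced G S + (length ks + 1)                   ≡⟨ cong (induced G S +_) (+-comm (length ks) 1) ⟩
    induced G S + length (k ∷ ks)                   ∎
    where
    open ≡-Reasoning
    w≢k : w ≢ k
    w≢k refl = w∉S k∈S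
    k∉ks′ : k ∉ˡ ks
    k∉ks′ k∈ks = All.lookup k∉ks k∈ks refl
    no-wk : addStar (G [ S ]) w ks w k ≢ true
    no-wk e with addStar⁻ ks e
    ... | inj₁ G[S]wk            = w∉S (proj₁ ([]-edge⁻ {G = G} {S = S} G[S]wk))
    ... | inj₂ (inj₁ (_ , k∈ks)) = k∉ks′ k∈ks
    ... | inj₂ (inj₂ (k≡w , _))  = w≢k (sym k≡w)
    no-kw : addStar (G [ S ]) w ks k w ≢ true
    no-kw e with addStar⁻ ks e
    ... | inj₁ G[S]kw            = w∉S (proj₁ (proj₂ ([]-edge⁻ {G = G} {S = S} G[S]kw)))
    ... | inj₂ (inj₁ (k≡w , _))  = w≢k (sym k≡w)
    ... | inj₂ (inj₂ (_ , k∈ks)) = k∉ks′ k∈ks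

  induced-∪-⁅⁆ : ∀ {G : Graph n} {S w} ks → Simple G → w ∉ S → Unique ks →
                 All (λ k → k ∈ S × G w k ≡ true) ks → induced G S + length ks ≤ induced G (S ∪ ⁅ w ⁆)
  induced-∪-⁅⁆ {G} {S} {w} ks (sym-G , _) w∉S ks! neighbours = begin
    induced G S + length ks            ≡⟨ numEdges-addStar ks w∉S ks! (All.map proj₁ neighbours) ⟨
    numEdges (addStar (G [ S ]) w ks)  ≤⟨ numEdges-mono star⊆ ⟩
    induced G (S ∪ ⁅ w ⁆)              ∎
    where
    open ≤-Reasoning
    star⊆ : addStar (G [ S ]) w ks ⊆ᴱ G [ S ∪ ⁅ w ⁆ ]
    star⊆ i j e with addStar⁻ ks e
    ... | inj₁ G[S]ij = []-mono {G = G} {H = G} {S = S} (λ _ _ → id) (p⊆p∪q ⁅ w ⁆) i j G[S]ij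
    ... | inj₂ (inj₁ (refl , j∈ks)) with j∈S , Gwj ← All.lookup neighbours j∈ks =
      []-edge⁺ {G = G} {S = S ∪ ⁅ w ⁆} (∈-∪ʳ S (x∈⁅x⁆ w)) (∈-∪ˡ ⁅ w ⁆ j∈S) Gwj
    ... | inj₂ (inj₂ (refl , i∈ks)) with i∈S , Gwi ← All.lookup neighbours i∈ks =
      []-edge⁺ {G = G} {S = S ∪ ⁅ w ⁆} (∈-∪ˡ ⁅ w ⁆ i∈S) (∈-∪ʳ S (x∈⁅x⁆ w)) (trans (sym-G i w) Gwi)

  -- Submodularity of the deficiency 2∣S∣ - i(S): k and l bound it from above on S and T,
  -- m from below on S ∩ T.
  deficiency-∪ : ∀ (G : Graph n) {S T} {k l m} →
                 2 * ∣ S ∣ ≤ induced G S + k → 2 * ∣ T ∣ ≤ induced G T + l →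
                 induced G (S ∩ T) + m ≤ 2 * ∣ S ∩ T ∣ →
                 2 * ∣ S ∪ T ∣ + m ≤ induced G (S ∪ T) + (k + l)
  deficiency-∪ G {S} {T} {k} {l} {m} S-dense T-dense S∩T-sparse =
    +-cancelʳ-≤ (induced G (S ∩ T)) _ _ (begin
      2 * ∣ S ∪ T ∣ + m + induced G (S ∩ T)             ≡⟨ +-assoc (2 * ∣ S ∪ T ∣) m _ ⟩
      2 * ∣ S ∪ T ∣ + (m + induced G (S ∩ T))           ≡⟨ cong (2 * ∣ S ∪ T ∣ +_) (+-comm m _) ⟩
      2 * ∣ S ∪ T ∣ + (induced G (S ∩ T) + m)           ≤⟨ +-monoʳ-≤ (2 * ∣ S ∪ T ∣) S∩T-sparse ⟩
      2 * ∣ S ∪ T ∣ + 2 * ∣ S ∩ T ∣                     ≡⟨ *-distribˡ-+ 2 ∣ S ∪ T ∣ _ ⟨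
      2 * (∣ S ∪ T ∣ + ∣ S ∩ T ∣)                       ≡⟨ cong (2 *_) (∣∪∣+∣∩∣ S T) ⟩
      2 * (∣ S ∣ + ∣ T ∣)                               ≡⟨ *-distribˡ-+ 2 ∣ S ∣ _ ⟩
      2 * ∣ S ∣ + 2 * ∣ T ∣                             ≤⟨ +-mono-≤ S-dense T-dense ⟩
      (induced G S + k) + (induced G T + l)             ≡⟨ interchange (induced G S) k _ l ⟩
      (induced G S + induced G T) + (k + l)             ≤⟨ +-monoˡ-≤ (k + l) (induced-supermodular G S T) ⟩
      (induced G (S ∪ T) + induced G (S ∩ T)) + (k + l) ≡⟨ xy∙z≈xz∙y (induced G (S ∪ T)) _ (k + l) ⟩
      induced G (S ∪ T) + (k + l) + induced G (S ∩ T)   ∎)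
    where open ≤-Reasoning

  deficiency-∪-⁅⁆ : ∀ {G : Graph n} {S w d} ks → Simple G → w ∉ S → Unique ks →
                    All (λ k → k ∈ S × G w k ≡ true) ks → 2 * ∣ S ∣ ≤ induced G S + d →
                    2 * ∣ S ∪ ⁅ w ⁆ ∣ + length ks ≤ induced G (S ∪ ⁅ w ⁆) + (2 + d)
  deficiency-∪-⁅⁆ {G} {S} {w} {d} ks simple w∉S ks! neighbours S-dense = begin
    2 * ∣ S ∪ ⁅ w ⁆ ∣ + length ks      ≤⟨ +-monoˡ-≤ (length ks) (*-monoʳ-≤ 2 (∣∪⁅⁆∣≤ S w)) ⟩
    2 * (∣ S ∣ + 1) + length ks        ≡⟨ cong (_+ length ks) (*-distribˡ-+ 2 ∣ S ∣ 1) ⟩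
    2 * ∣ S ∣ + 2 + length ks          ≤⟨ +-monoˡ-≤ (length ks) (+-monoˡ-≤ 2 S-dense) ⟩
    induced G S + d + 2 + length ks    ≡⟨ rearrange (induced G S) d (length ks) ⟩
    induced G S + length ks + (2 + d)  ≤⟨ +-monoˡ-≤ (2 + d) (induced-∪-⁅⁆ ks simple w∉S ks! neighbours) ⟩
    induced G (S ∪ ⁅ w ⁆) + (2 + d)    ∎
    where
    open ≤-Reasoning
    rearrange : ∀ i d k → i + d + 2 + k ≡ i + k + (2 + d)
    rearrange = solve-∀

  module _ {G : Graph n} where

    ⊆V-⊆ : ∀ {S T} → S ⊆ T → T ⊆V G → S ⊆V G
    ⊆V-⊆ S⊆T T⊆V i i∈S = T⊆V i (S⊆T i∈S)

    ⊆V-∪ : ∀ {S T} → S ⊆V G → T ⊆V G → (S ∪ T) ⊆V G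
    ⊆V-∪ {S} {T} S⊆V T⊆V i i∈S∪T = [ S⊆V i , T⊆V i ] (x∈p∪q⁻ S T i∈S∪T)

    ⁅⁆-⊆V : ∀ {i} → IsVertex G i → ⁅ i ⁆ ⊆V G
    ⁅⁆-⊆V {i} i-vertex j j∈⁅i⁆ rewrite x∈⁅y⁆⇒x≡y i j∈⁅i⁆ = i-vertex

    ⊆V-mono : ∀ {H : Graph n} {S} → G ⊆ᴱ H → S ⊆V G → S ⊆V H
    ⊆V-mono G⊆H S⊆V i i∈S with j , Gij ← S⊆V i i∈S = j , G⊆H i j Gij

    ⊆V-[] : ∀ {S X} → S ⊆V G [ X ] → S ⊆ X
    ⊆V-[] {S} {X} S⊆V {i} i∈S with j , G[X]ij ← S⊆V i i∈S = proj₁ ([]-edge⁻ {G = G} {S = X} G[X]ij)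

    isVertex? : ∀ i → Dec (IsVertex G i)
    isVertex? i = Fin.any? λ j → G i j Bool.≟ true

RIndependent-⊆ᴱ : ∀ {n} {H G : Graph n} → H ⊆ᴱ G → RIndependent G → RIndependent H
RIndependent-⊆ᴱ H⊆G G-independent S S⊆V 2≤∣S∣ =
  ≤-trans (+-monoˡ-≤ 3 (induced-mono {S = S} H⊆G ⊆-refl)) (G-independent S (⊆V-mono H⊆G S⊆V) 2≤∣S∣)

-- Tight sets

Tight : ∀ {n} → Graph n → Subset n → Set
Tight G S = S ⊆V G × induced G S + 3 ≡ 2 * ∣ S ∣

module _ {n : ℕ} {G : Graph n} where

  tight⇒dense : ∀ {S} → Tight G S → 2 * ∣ S ∣ ≤ induced G S + 3
  tight⇒dense (_ , S-tight) = ≤-reflexive (sym S-tight)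

  tight? : ∀ S → Dec (Tight G S)
  tight? S = Fin.all? (λ i → (i ∈? S) →-dec isVertex? {G = G} i) ×-dec (induced G S + 3 ℕ.≟ 2 * ∣ S ∣)

  module _ (independent : RIndependent G) where

    dense⇒tight : ∀ {S} → S ⊆V G → 2 ≤ ∣ S ∣ → 2 * ∣ S ∣ ≤ induced G S + 3 → Tight G S
    dense⇒tight S⊆V 2≤∣S∣ dense = S⊆V , ≤-antisym (independent _ S⊆V 2≤∣S∣) dense

    tight-∪ : ∀ {S T} → Tight G S → Tight G T → 2 ≤ ∣ S ∩ T ∣ → Tight G (S ∪ T)
    tight-∪ {S} {T} S-tight T-tight 2≤∣S∩T∣ =
      dense⇒tight (⊆V-∪ (proj₁ S-tight) (proj₁ T-tight))
        (≤-trans 2≤∣S∩T∣ (≤-trans (∣p∩q∣≤∣p∣ S T) (∣p∣≤∣p∪q∣ S T)))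
        (+-cancelʳ-≤ 3 _ _ (≤-trans union-bound (≤-reflexive (sym (+-assoc _ 3 3)))))
      where
      union-bound : 2 * ∣ S ∪ T ∣ + 3 ≤ induced G (S ∪ T) + (3 + 3)
      union-bound = deficiency-∪ G {S} {T} (tight⇒dense S-tight) (tight⇒dense T-tight)
                      (independent (S ∩ T) (⊆V-⊆ (p∩q⊆p S T) (proj₁ S-tight)) 2≤∣S∩T∣)

    -- The deficiency of T₁ ∪ T₂ is at most 3 + 3 - 2, so that of (T₁ ∪ T₂) ∪ T₃ is at most 4 + 3 - 4.
    tight-∪-∪ : ∀ {T₁ T₂ T₃} → Tight G T₁ → Tight G T₂ → Tight G T₃ →
                1 ≤ ∣ T₁ ∩ T₂ ∣ → induced G (T₁ ∩ T₂) ≡ 0 →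
                2 ≤ ∣ (T₁ ∪ T₂) ∩ T₃ ∣ → induced G ((T₁ ∪ T₂) ∩ T₃) ≡ 0 → Tight G ((T₁ ∪ T₂) ∪ T₃)
    tight-∪-∪ {T₁} {T₂} {T₃} T₁-tight T₂-tight T₃-tight 1≤∣T₁₂∣ T₁₂-edgeless 2≤∣I∣ I-edgeless =
      dense⇒tight (⊆V-∪ (⊆V-∪ (proj₁ T₁-tight) (proj₁ T₂-tight)) (proj₁ T₃-tight))
        (≤-trans 2≤∣I∣ (≤-trans (∣p∩q∣≤∣p∣ (T₁ ∪ T₂) T₃) (∣p∣≤∣p∪q∣ (T₁ ∪ T₂) T₃)))
        (+-cancelʳ-≤ 4 _ _ (≤-trans W-deficiency (≤-reflexive (sym (+-assoc _ 3 4)))))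
      where
      T₁₂-sparse : induced G (T₁ ∩ T₂) + 2 ≤ 2 * ∣ T₁ ∩ T₂ ∣
      T₁₂-sparse rewrite T₁₂-edgeless = *-monoʳ-≤ 2 1≤∣T₁₂∣
      I-sparse : induced G ((T₁ ∪ T₂) ∩ T₃) + 4 ≤ 2 * ∣ (T₁ ∪ T₂) ∩ T₃ ∣
      I-sparse rewrite I-edgeless = *-monoʳ-≤ 2 2≤∣I∣
      U-deficiency : 2 * ∣ T₁ ∪ T₂ ∣ + 2 ≤ induced G (T₁ ∪ T₂) + (3 + 3)
      U-deficiency = deficiency-∪ G {T₁} {T₂} (tight⇒dense T₁-tight) (tight⇒dense T₂-tight) T₁₂-sparse
      U-dense : 2 * ∣ T₁ ∪ T₂ ∣ ≤ induced G (T₁ ∪ T₂) + 4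
      U-dense = +-cancelʳ-≤ 2 _ _ (≤-trans U-deficiency (≤-reflexive (sym (+-assoc _ 4 2))))
      W-deficiency : 2 * ∣ (T₁ ∪ T₂) ∪ T₃ ∣ + 4 ≤ induced G ((T₁ ∪ T₂) ∪ T₃) + (4 + 3)
      W-deficiency = deficiency-∪ G {T₁ ∪ T₂} {T₃} U-dense (tight⇒dense T₃-tight) I-sparse

  module _ (simple : Simple G) (independent : RIndependent G) where

    tight⇒neighbour : ∀ {X w} → Tight G X → w ∈ X → 2 ≤ ∣ X - w ∣ → ∃[ j ] (j ∈ X × G w j ≡ true)
    tight⇒neighbour {X} {w} (X⊆V , X-tight) w∈X 2≤∣X-w∣
      with Fin.any? (λ j → (j ∈? X) ×-dec (G w j Bool.≟ true))
    ... | yes neighbour = neighbour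
    ... | no isolated = contradiction 2∣X∣<2∣X∣ (<-irrefl refl)
      where
      G[X]⊆G[X-w] : G [ X ] ⊆ᴱ G [ X - w ]
      G[X]⊆G[X-w] i j e with i∈X , j∈X , Gij ← []-edge⁻ {G = G} {S = X} e =
        []-edge⁺ {G = G} {S = X - w} (x∈p∧x≢y⇒x∈p-y i∈X i≢w) (x∈p∧x≢y⇒x∈p-y j∈X j≢w) Gij
        where
        i≢w : i ≢ w
        i≢w refl = isolated (j , j∈X , Gij)
        j≢w : j ≢ w
        j≢w refl = isolated (i , i∈X , trans (proj₁ simple j i) Gij)
      2∣X∣<2∣X∣ : 2 * ∣ X ∣ < 2 * ∣ X ∣
      2∣X∣<2∣X∣ = begin-strict
        2 * ∣ X ∣              ≡⟨ X-tight ⟨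
        induced G X + 3        ≤⟨ +-monoˡ-≤ 3 (numEdges-mono G[X]⊆G[X-w]) ⟩
        induced G (X - w) + 3  ≤⟨ independent (X - w) (⊆V-⊆ (p─q⊆p X ⁅ w ⁆) X⊆V) 2≤∣X-w∣ ⟩
        2 * ∣ X - w ∣          <⟨ *-monoʳ-< 2 (x∈p⇒∣p-x∣<∣p∣ w∈X) ⟩
        2 * ∣ X ∣              ∎
        where open ≤-Reasoning

    edge-tight : ∀ {a b} → a ≢ b → IsVertex G a → IsVertex G b → G a b ≡ true → Tight G (⁅ b ⁆ ∪ ⁅ a ⁆)
    edge-tight {a} {b} a≢b a-vertex b-vertex Gab =
      dense⇒tight independent (⊆V-∪ (⁅⁆-⊆V b-vertex) (⁅⁆-⊆V a-vertex))
        (two-members⇒2≤∣∣ a≢b (∈-∪ʳ ⁅ b ⁆ (x∈⁅x⁆ a)) (∈-∪ˡ ⁅ a ⁆ (x∈⁅x⁆ b)))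
        (+-cancelʳ-≤ 1 _ _ (≤-trans (deficiency-∪-⁅⁆ (b ∷ []) simple (x≢y⇒x∉⁅y⁆ a≢b) ([] ∷ [])
                                        ((x∈⁅x⁆ b , Gab) ∷ []) ⁅b⁆-dense)
                                     (≤-reflexive (sym (+-assoc _ 3 1)))))
      where
      ⁅b⁆-dense : 2 * ∣ ⁅ b ⁆ ∣ ≤ induced G ⁅ b ⁆ + 2
      ⁅b⁆-dense = subst (λ c → 2 * c ≤ induced G ⁅ b ⁆ + 2) (sym (∣⁅x⁆∣≡1 b)) (m≤n+m 2 (induced G ⁅ b ⁆))

    tight-∪-⁅⁆ : ∀ {T w x y} → Tight G T → w ∉ T → IsVertex G w → x ≢ y → x ∈ T → y ∈ T →
                 G w x ≡ true → G w y ≡ true → Tight G (T ∪ ⁅ w ⁆)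
    tight-∪-⁅⁆ {T} {w} {x} {y} T-tight w∉T w-vertex x≢y x∈T y∈T Gwx Gwy =
      dense⇒tight independent (⊆V-∪ (proj₁ T-tight) (⁅⁆-⊆V w-vertex))
        (two-members⇒2≤∣∣ x≢y (∈-∪ˡ ⁅ w ⁆ x∈T) (∈-∪ˡ ⁅ w ⁆ y∈T))
        (+-cancelʳ-≤ 2 _ _ (≤-trans (deficiency-∪-⁅⁆ (x ∷ y ∷ []) simple w∉T ((x≢y ∷ []) ∷ [] ∷ [])
                                       ((x∈T , Gwx) ∷ (y∈T , Gwy) ∷ []) (tight⇒dense T-tight))
                                     (≤-reflexive (sym (+-assoc _ 3 2)))))

-- The fundamental circuit of a minimum tight set

module MinimumTightSet
  {n : ℕ} {B : Graph n} (simple : Simple B) (independent : RIndependent B)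
  {a b : Fin n} (a≢b : a ≢ b) (Bab : B a b ≡ false)
  {X : Subset n} (X-tight : Tight B X) (a∈X : a ∈ X) (b∈X : b ∈ X)
  (X-minimum : ∀ {Y} → Tight B Y → a ∈ Y → b ∈ Y → ∣ X ∣ ≤ ∣ Y ∣)
  where

  A : Graph n
  A = addEdge B a b

  C : Graph n
  C = A [ X ]

  private
    A-simple : Simple A
    A-simple = addEdge-simple simple a≢b

    C-simple : Simple C
    C-simple = []-simple {G = A} {S = X} A-simple

  X⊆V[C] : X ⊆V C
  X⊆V[C] w w∈X = case ((w ≟ a) , (w ≟ b)) of λ where
      (yes refl , _)    → b , []-edge⁺ {G = A} {S = X} a∈X b∈X (addEdge-new B a b)
      (no _ , yes refl) → a , []-edge⁺ {G = A} {S = X} b∈X a∈X Aba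
      (no w≢a , no w≢b) → other-neighbour w≢a w≢b
    where
    Aba : A b a ≡ true
    Aba = trans (proj₁ A-simple b a) (addEdge-new B a b)
    other-neighbour : w ≢ a → w ≢ b → IsVertex C w
    other-neighbour w≢a w≢b
      with j , j∈X , Bwj ← tight⇒neighbour simple independent X-tight w∈X
             (two-members⇒2≤∣∣ a≢b (x∈p∧x≢y⇒x∈p-y a∈X (≢-sym w≢a)) (x∈p∧x≢y⇒x∈p-y b∈X (≢-sym w≢b)))
      = j , []-edge⁺ {G = A} {S = X} w∈X j∈X (addEdge-⊇ B a b w j Bwj)

  C-dependent : RDependent C
  C-dependent C-independent = m+1+n≰m (2 * ∣ X ∣) (begin
    2 * ∣ X ∣ + 1          ≡⟨ cong (_+ 1) (proj₂ X-tight) ⟨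
    induced B X + 3 + 1    ≡⟨ xy∙z≈xz∙y (induced B X) 3 1 ⟩
    induced B X + 1 + 3    ≤⟨ +-monoˡ-≤ 3 B<A ⟩
    induced A X + 3        ≡⟨ cong (_+ 3) (induced-[] {G = A} {S = X} {X = X} ⊆-refl) ⟨
    induced C X + 3        ≤⟨ C-independent X X⊆V[C] (two-members⇒2≤∣∣ a≢b a∈X b∈X) ⟩
    2 * ∣ X ∣              ∎)
    where
    open ≤-Reasoning
    B<A : induced B X + 1 ≤ induced A X
    B<A = induced-⊂ᴱ (addEdge-⊇ B a b) simple A-simple a∈X b∈X Bab (addEdge-new B a b)

  -- A smaller set containing a and b is not tight, which leaves room for the edge ab.
  A-sparse-below-X : ∀ {S} → S ⊆ X → ∣ S ∣ < ∣ X ∣ → S ⊆V B → 2 ≤ ∣ S ∣ → induced A S + 3 ≤ 2 * ∣ S ∣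
  A-sparse-below-X {S} S⊆X ∣S∣<∣X∣ S⊆V 2≤∣S∣ with (a ∈? S) ×-dec (b ∈? S)
  ... | yes (a∈S , b∈S) = begin
    induced A S + 3        ≤⟨ +-monoˡ-≤ 3 (induced-addEdge-≤ B S a≢b) ⟩
    induced B S + 1 + 3    ≡⟨ xy∙z≈xz∙y (induced B S) 1 3 ⟩
    induced B S + 3 + 1    ≡⟨ +-comm _ 1 ⟩
    suc (induced B S + 3)  ≤⟨ ≤∧≢⇒< (independent S S⊆V 2≤∣S∣) S-not-tight ⟩
    2 * ∣ S ∣              ∎
    where
    open ≤-Reasoning
    S-not-tight : induced B S + 3 ≢ 2 * ∣ S ∣
    S-not-tight S-tight = <⇒≱ ∣S∣<∣X∣ (X-minimum (S⊆V , S-tight) a∈S b∈S)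
  ... | no ¬a,b∈S = ≤-trans (+-monoˡ-≤ 3 (induced-addEdge-∉ B ¬a,b∈S)) (independent S S⊆V 2≤∣S∣)

  C-minimal : ∀ C′ → Simple C′ → C′ ⊂ᴱ C → RIndependent C′
  C-minimal C′ C′-simple (C′⊆C , i₀ , j₀ , Ci₀j₀ , C′i₀j₀) S S⊆V[C′] 2≤∣S∣ =
    case (i₀ ∈? S) ×-dec (j₀ ∈? S) of λ where
      (yes (i₀∈S , j₀∈S)) → edge-inside i₀∈S j₀∈S
      (no ¬i₀,j₀∈S)       → edge-outside ¬i₀,j₀∈S
    where
    open ≤-Reasoning
    S⊆X : S ⊆ X
    S⊆X = ⊆V-[] {G = A} (⊆V-mono C′⊆C S⊆V[C′])
    S⊆V[B] : S ⊆V B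
    S⊆V[B] = ⊆V-⊆ S⊆X (proj₁ X-tight)
    edge-inside : i₀ ∈ S → j₀ ∈ S → induced C′ S + 3 ≤ 2 * ∣ S ∣
    edge-inside i₀∈S j₀∈S = +-cancelʳ-≤ 1 _ _ (begin
      induced C′ S + 3 + 1  ≡⟨ xy∙z≈xz∙y (induced C′ S) 3 1 ⟩
      induced C′ S + 1 + 3  ≤⟨ +-monoˡ-≤ 3 (induced-⊂ᴱ C′⊆C C′-simple C-simple i₀∈S j₀∈S C′i₀j₀ Ci₀j₀) ⟩
      induced C S + 3       ≡⟨ cong (_+ 3) (induced-[] {G = A} {S = S} {X = X} S⊆X) ⟩
      induced A S + 3       ≤⟨ +-monoˡ-≤ 3 (induced-addEdge-≤ B S a≢b) ⟩
      induced B S + 1 + 3   ≡⟨ xy∙z≈xz∙y (induced B S) 1 3 ⟩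
      induced B S + 3 + 1   ≤⟨ +-monoˡ-≤ 1 (independent S S⊆V[B] 2≤∣S∣) ⟩
      2 * ∣ S ∣ + 1         ∎)
    edge-outside : ¬ (i₀ ∈ S × j₀ ∈ S) → induced C′ S + 3 ≤ 2 * ∣ S ∣
    edge-outside ¬i₀,j₀∈S = begin
      induced C′ S + 3      ≤⟨ +-monoˡ-≤ 3 (induced-mono {S = S} C′⊆C ⊆-refl) ⟩
      induced C S + 3       ≡⟨ cong (_+ 3) (induced-[] {G = A} {S = S} {X = X} S⊆X) ⟩
      induced A S + 3       ≤⟨ A-sparse-below-X S⊆X (p⊂q⇒∣p∣<∣q∣ (S⊆X , missing)) S⊆V[B] 2≤∣S∣ ⟩
      2 * ∣ S ∣             ∎
      where
      missing : ∃[ x ] (x ∈ X × x ∉ S)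
      missing with i₀∈X , j₀∈X , _ ← []-edge⁻ {G = A} {S = X} Ci₀j₀ | i₀ ∈? S
      ... | yes i₀∈S = j₀ , j₀∈X , λ j₀∈S → ¬i₀,j₀∈S (i₀∈S , j₀∈S)
      ... | no i₀∉S  = i₀ , i₀∈X , i₀∉S

  C-fundamental : FundamentalCircuit B a b C
  C-fundamental = C-simple , []-⊆ᴱ {G = A} {S = X} , C-dependent , C-minimal

FundamentalCircuit⇒RDependent : ∀ {n} {B : Graph n} {a b C} → FundamentalCircuit B a b C →
                                RDependent (addEdge B a b)
FundamentalCircuit⇒RDependent (_ , C⊆A , C-dependent , _) = C-dependent ∘ RIndependent-⊆ᴱ C⊆A

module _ {n : ℕ} {B : Graph n} where

  RBase⇒RIndependent : RBase B → RIndependent B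
  RBase⇒RIndependent (|B|+3≡2v , proper-sparse) S S⊆V 2≤∣S∣ with ∣ S ∣ <? numVertices B
  ... | yes ∣S∣<v = proper-sparse S S⊆V 2≤∣S∣ ∣S∣<v
  ... | no ∣S∣≮v = begin
    induced B S + 3    ≤⟨ +-monoˡ-≤ 3 (induced≤numEdges B S) ⟩
    numEdges B + 3     ≡⟨ |B|+3≡2v ⟩
    2 * numVertices B  ≤⟨ *-monoʳ-≤ 2 (≮⇒≥ ∣S∣≮v) ⟩
    2 * ∣ S ∣          ∎
    where open ≤-Reasoning

  ∈vertexSet⁺ : ∀ {i} → IsVertex B i → i ∈ vertexSet B
  ∈vertexSet⁺ {i} (j , Bij) = lookup⇒[]= i (vertexSet B)
    (trans (lookup∘tabulate _ i) (Equivalence.to T-≡ (any⁺ (B i) (tabulate⁺ j (Equivalence.from T-≡ Bij)))))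

  ∈vertexSet⁻ : ∀ {i} → i ∈ vertexSet B → IsVertex B i
  ∈vertexSet⁻ {i} i∈V
    with j , Bij ← satisfied (any⁻ (B i) (allFin n)
                     (Equivalence.from T-≡ (trans (sym (lookup∘tabulate _ i)) ([]=⇒lookup i∈V))))
    = j , Equivalence.to T-≡ Bij

  vertexSet-tight : Simple B → RBase B → Tight B (vertexSet B)
  vertexSet-tight simple (|B|+3≡2v , _) =
    (λ _ → ∈vertexSet⁻) , trans (cong (_+ 3) induced-V≡|B|) |B|+3≡2v
    where
    B⊆B[V] : B ⊆ᴱ B [ vertexSet B ]
    B⊆B[V] i j Bij = []-edge⁺ {G = B} {S = vertexSet B}
                       (∈vertexSet⁺ (j , Bij)) (∈vertexSet⁺ (neighbour-vertex simple Bij)) Bij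
    induced-V≡|B| : induced B (vertexSet B) ≡ numEdges B
    induced-V≡|B| = ≤-antisym (induced≤numEdges B (vertexSet B)) (numEdges-mono B⊆B[V])

  minimum-tight-set : ∀ {a b} → Simple B → RBase B → IsVertex B a → IsVertex B b →
                      ∃[ X ] ((Tight B X × a ∈ X × b ∈ X) × ∀ {Y} → Tight B Y × a ∈ Y × b ∈ Y → ∣ X ∣ ≤ ∣ Y ∣)
  minimum-tight-set {a} {b} simple base a-vertex b-vertex =
    minimum-∣∣ (λ S → tight? S ×-dec (a ∈? S) ×-dec (b ∈? S))
               (vertexSet-tight simple base , ∈vertexSet⁺ a-vertex , ∈vertexSet⁺ b-vertex)

-- Vertices of degree three

three-neighbours : ∀ {n} (G : Graph n) v → 3 ≤ degree G v →
                   ∃[ x ] ∃[ y ] ∃[ z ] (Unique (x ∷ y ∷ z ∷ []) × All (λ k → G v k ≡ true) (x ∷ y ∷ z ∷ []))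
three-neighbours {n} G v 3≤deg =
  first-three (filterᵇ (G v) (allFin n)) 3≤deg (Unique.filter⁺ (T? ∘ G v) (Unique.allFin⁺ n))
              (Equivalence.to T-≡ ∘ proj₂ ∘ ∈-filter⁻ (T? ∘ G v) {xs = allFin n})
  where
  first-three : ∀ ks → 3 ≤ length ks → Unique ks → (∀ {k} → k ∈ˡ ks → G v k ≡ true) →
                ∃[ x ] ∃[ y ] ∃[ z ] (Unique (x ∷ y ∷ z ∷ []) × All (λ k → G v k ≡ true) (x ∷ y ∷ z ∷ []))
  first-three (x ∷ y ∷ z ∷ _) (s≤s (s≤s (s≤s _))) ((x≢y ∷ x≢z ∷ _) ∷ (y≢z ∷ _) ∷ _) adjacent =
    x , y , z , (x≢y ∷ x≢z ∷ []) ∷ (y≢z ∷ []) ∷ [] ∷ [] ,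
    adjacent (here refl) ∷ adjacent (there (here refl)) ∷ adjacent (there (there (here refl))) ∷ []

TightAvoiding : ∀ {n} → Graph n → Fin n → List (Fin n) → Set
TightAvoiding G v ks = ∃[ S ] (Tight G S × v ∉ S × All (_∈ S) ks)

module _ {n : ℕ} {B : Graph n} where

  TightAvoiding-swap : ∀ {v a b} → TightAvoiding B v (a ∷ b ∷ []) → TightAvoiding B v (b ∷ a ∷ [])
  TightAvoiding-swap (S , S-tight , v∉S , a∈S ∷ b∈S ∷ []) = S , S-tight , v∉S , b∈S ∷ a∈S ∷ []

  tightAvoiding? : ∀ v ks → Dec (TightAvoiding B v ks)
  tightAvoiding? v ks = anySubset? λ S → tight? S ×-dec ¬? (v ∈? S) ×-dec All.all? (_∈? S) ks

module _ {n : ℕ} {B : Graph n} (simple : Simple B) where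

  module _ (independent : RIndependent B) where

    -- If two of the sets share two vertices, their union is tight. Otherwise T₁ ∩ T₂ = {q} and
    -- (T₁ ∪ T₂) ∩ T₃ = {p , r}, which induces no edge because pr is not one.
    TightAvoiding-glue-nonedge : ∀ {v p q r} → p ≢ r → B p r ≡ false →
                                 TightAvoiding B v (p ∷ q ∷ []) → TightAvoiding B v (q ∷ r ∷ []) →
                                 TightAvoiding B v (p ∷ r ∷ []) → TightAvoiding B v (p ∷ q ∷ r ∷ [])
    TightAvoiding-glue-nonedge {v} {p} {q} {r} p≢r Bpr
      (T₁ , T₁-tight , v∉T₁ , p∈T₁ ∷ q∈T₁ ∷ []) (T₂ , T₂-tight , v∉T₂ , q∈T₂ ∷ r∈T₂ ∷ [])
      (T₃ , T₃-tight , v∉T₃ , p∈T₃ ∷ r∈T₃ ∷ [])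
      with 2 ≤? ∣ T₁ ∩ T₂ ∣ | 2 ≤? ∣ T₁ ∩ T₃ ∣ | 2 ≤? ∣ T₂ ∩ T₃ ∣
    ... | yes big | _ | _ = T₁ ∪ T₂ , tight-∪ independent T₁-tight T₂-tight big , ∉-∪ v∉T₁ v∉T₂ ,
                            ∈-∪ˡ T₂ p∈T₁ ∷ ∈-∪ˡ T₂ q∈T₁ ∷ ∈-∪ʳ T₁ r∈T₂ ∷ []
    ... | no _ | yes big | _ = T₁ ∪ T₃ , tight-∪ independent T₁-tight T₃-tight big , ∉-∪ v∉T₁ v∉T₃ ,
                               ∈-∪ˡ T₃ p∈T₁ ∷ ∈-∪ˡ T₃ q∈T₁ ∷ ∈-∪ʳ T₁ r∈T₃ ∷ []
    ... | no _ | no _ | yes big = T₂ ∪ T₃ , tight-∪ independent T₂-tight T₃-tight big , ∉-∪ v∉T₂ v∉T₃ ,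
                                  ∈-∪ʳ T₂ p∈T₃ ∷ ∈-∪ˡ T₃ q∈T₂ ∷ ∈-∪ˡ T₃ r∈T₂ ∷ []
    ... | no small₁₂ | no small₁₃ | no small₂₃ =
      (T₁ ∪ T₂) ∪ T₃ ,
      tight-∪-∪ independent T₁-tight T₂-tight T₃-tight (member⇒1≤∣∣ (x∈p∩q⁺ (q∈T₁ , q∈T₂)))
        (induced-edgeless {G = B} {S = T₁ ∩ T₂} T₁₂-edgeless)
        (two-members⇒2≤∣∣ p≢r (x∈p∩q⁺ (p∈T₁₂ , p∈T₃)) (x∈p∩q⁺ (r∈T₁₂ , r∈T₃)))
        (induced-edgeless {G = B} {S = (T₁ ∪ T₂) ∩ T₃} I-edgeless) ,
      ∉-∪ (∉-∪ v∉T₁ v∉T₂) v∉T₃ ,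
      ∈-∪ˡ T₃ p∈T₁₂ ∷ ∈-∪ˡ T₃ (∈-∪ˡ T₂ q∈T₁) ∷ ∈-∪ˡ T₃ r∈T₁₂ ∷ []
      where
      p∈T₁₂ : p ∈ T₁ ∪ T₂
      p∈T₁₂ = ∈-∪ˡ T₂ p∈T₁
      r∈T₁₂ : r ∈ T₁ ∪ T₂
      r∈T₁₂ = ∈-∪ʳ T₁ r∈T₂
      T₁₂-edgeless : ∀ {i j} → i ∈ T₁ ∩ T₂ → j ∈ T₁ ∩ T₂ → B i j ≡ false
      T₁₂-edgeless i∈ j∈ rewrite ∣∣<2⇒members-≡ small₁₂ i∈ j∈ = proj₂ simple _
      I-members : ∀ {i} → i ∈ (T₁ ∪ T₂) ∩ T₃ → i ≡ p ⊎ i ≡ r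
      I-members i∈I with i∈T₁₂ , i∈T₃ ← x∈p∩q⁻ (T₁ ∪ T₂) T₃ i∈I | x∈p∪q⁻ T₁ T₂ i∈T₁₂
      ... | inj₁ i∈T₁ = inj₁ (∣∣<2⇒members-≡ small₁₃ (x∈p∩q⁺ (i∈T₁ , i∈T₃)) (x∈p∩q⁺ (p∈T₁ , p∈T₃)))
      ... | inj₂ i∈T₂ = inj₂ (∣∣<2⇒members-≡ small₂₃ (x∈p∩q⁺ (i∈T₂ , i∈T₃)) (x∈p∩q⁺ (r∈T₂ , r∈T₃)))
      I-edgeless : ∀ {i j} → i ∈ (T₁ ∪ T₂) ∩ T₃ → j ∈ (T₁ ∪ T₂) ∩ T₃ → B i j ≡ false
      I-edgeless i∈I j∈I with I-members i∈I | I-members j∈I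
      ... | inj₁ refl | inj₁ refl = proj₂ simple p
      ... | inj₁ refl | inj₂ refl = Bpr
      ... | inj₂ refl | inj₁ refl = trans (proj₁ simple r p) Bpr
      ... | inj₂ refl | inj₂ refl = proj₂ simple r

    TightAvoiding-glue : ∀ {v x y z} → IsVertex B z → z ≢ v → x ≢ y → y ≢ z → x ≢ z →
                         TightAvoiding B v (x ∷ y ∷ []) → TightAvoiding B v (y ∷ z ∷ []) →
                         TightAvoiding B v (x ∷ z ∷ []) → TightAvoiding B v (x ∷ y ∷ z ∷ [])
    TightAvoiding-glue {v} {x} {y} {z} z-vertex z≢v x≢y y≢z x≢z Txy Tyz Txz
      with B x z in Bxz | B y z in Byz
    ... | false | _ = TightAvoiding-glue-nonedge x≢z Bxz Txy Tyz Txz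
    ... | true | false
      with S , S-tight , v∉S , y∈S ∷ x∈S ∷ z∈S ∷ [] ←
             TightAvoiding-glue-nonedge y≢z Byz (TightAvoiding-swap Txy) Txz Tyz
      = S , S-tight , v∉S , x∈S ∷ y∈S ∷ z∈S ∷ []
    ... | true | true with T , T-tight , v∉T , x∈T ∷ y∈T ∷ [] ← Txy | z ∈? T
    ...   | yes z∈T = T , T-tight , v∉T , x∈T ∷ y∈T ∷ z∈T ∷ []
    ...   | no z∉T  = T ∪ ⁅ z ⁆ ,
                      tight-∪-⁅⁆ simple independent T-tight z∉T z-vertex x≢y x∈T y∈T
                        (trans (proj₁ simple z x) Bxz) (trans (proj₁ simple z y) Byz) ,
                      ∉-∪ v∉T (x≢y⇒x∉⁅y⁆ (≢-sym z≢v)) ,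
                      ∈-∪ˡ ⁅ z ⁆ x∈T ∷ ∈-∪ˡ ⁅ z ⁆ y∈T ∷ ∈-∪ʳ T (x∈⁅x⁆ z) ∷ []

    ¬TightAvoiding-three-neighbours : ∀ {v x y z} → IsVertex B v → Unique (x ∷ y ∷ z ∷ []) →
                                      All (λ k → B v k ≡ true) (x ∷ y ∷ z ∷ []) →
                                      ¬ TightAvoiding B v (x ∷ y ∷ z ∷ [])
    ¬TightAvoiding-three-neighbours {v} {x} {y} {z} v-vertex xyz!@((x≢y ∷ _) ∷ _) (Bvx ∷ Bvy ∷ Bvz ∷ [])
                                    (W , W-tight , v∉W , x∈W ∷ y∈W ∷ z∈W ∷ []) =
      m+1+n≰m (induced B W′ + (2 + 3)) (begin
        induced B W′ + (2 + 3) + 1  ≡⟨ trans (+-assoc _ 5 1) (sym (+-assoc _ 3 3)) ⟩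
        induced B W′ + 3 + 3        ≤⟨ +-monoˡ-≤ 3 (independent W′ W′⊆V 2≤∣W′∣) ⟩
        2 * ∣ W′ ∣ + 3              ≤⟨ deficiency-∪-⁅⁆ (x ∷ y ∷ z ∷ []) simple v∉W xyz!
                                          ((x∈W , Bvx) ∷ (y∈W , Bvy) ∷ (z∈W , Bvz) ∷ []) (tight⇒dense W-tight) ⟩
        induced B W′ + (2 + 3)      ∎)
      where
      open ≤-Reasoning
      W′ : Subset n
      W′ = W ∪ ⁅ v ⁆
      W′⊆V : W′ ⊆V B
      W′⊆V = ⊆V-∪ (proj₁ W-tight) (⁅⁆-⊆V v-vertex)
      2≤∣W′∣ : 2 ≤ ∣ W′ ∣
      2≤∣W′∣ = two-members⇒2≤∣∣ x≢y (∈-∪ˡ ⁅ v ⁆ x∈W) (∈-∪ˡ ⁅ v ⁆ y∈W)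

    ¬TightAvoiding-neighbour-pair : ∀ {v x y z} → IsVertex B v → Unique (x ∷ y ∷ z ∷ []) →
                                    All (λ k → B v k ≡ true) (x ∷ y ∷ z ∷ []) →
                                    ∃[ a ] ∃[ b ] (a ≢ b × B v a ≡ true × B v b ≡ true ×
                                                   ¬ TightAvoiding B v (a ∷ b ∷ []))
    ¬TightAvoiding-neighbour-pair {v} {x} {y} {z} v-vertex xyz!@((x≢y ∷ x≢z ∷ []) ∷ (y≢z ∷ []) ∷ [] ∷ [])
                                  Bv@(Bvx ∷ Bvy ∷ Bvz ∷ [])
      with tightAvoiding? v (x ∷ y ∷ []) | tightAvoiding? v (y ∷ z ∷ []) | tightAvoiding? v (x ∷ z ∷ [])
    ... | no ¬Txy | _ | _ = x , y , x≢y , Bvx , Bvy , ¬Txy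
    ... | yes _ | no ¬Tyz | _ = y , z , y≢z , Bvy , Bvz , ¬Tyz
    ... | yes _ | yes _ | no ¬Txz = x , z , x≢z , Bvx , Bvz , ¬Txz
    ... | yes Txy | yes Tyz | yes Txz = contradiction
      (TightAvoiding-glue (neighbour-vertex simple Bvz) (neighbour-≢ simple Bvz) x≢y y≢z x≢z Txy Tyz Txz)
      (¬TightAvoiding-three-neighbours v-vertex xyz! Bv)

  fundamental-circuit-through : ∀ {v a b} → RBase B → a ≢ b → B v a ≡ true → B v b ≡ true →
                                ¬ TightAvoiding B v (a ∷ b ∷ []) →
                                B a b ≡ false × ∃[ C ] (FundamentalCircuit B a b C × IsVertex C v)
  fundamental-circuit-through {v} {a} {b} base a≢b Bva Bvb ¬Tab
    with X , (X-tight , a∈X , b∈X) , X-minimum ←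
           minimum-tight-set simple base (neighbour-vertex simple Bva) (neighbour-vertex simple Bvb)
    = Bab≡false , C , C-fundamental , X⊆V[C] v v∈X
    where
    independent : RIndependent B
    independent = RBase⇒RIndependent base
    Bab≡false : B a b ≡ false
    Bab≡false = ¬-not λ Bab →
      ¬Tab (⁅ b ⁆ ∪ ⁅ a ⁆ ,
            edge-tight simple independent a≢b (neighbour-vertex simple Bva) (neighbour-vertex simple Bvb) Bab ,
            ∉-∪ (x≢y⇒x∉⁅y⁆ (≢-sym (neighbour-≢ simple Bvb))) (x≢y⇒x∉⁅y⁆ (≢-sym (neighbour-≢ simple Bva))) ,
            ∈-∪ʳ ⁅ b ⁆ (x∈⁅x⁆ a) ∷ ∈-∪ˡ ⁅ a ⁆ (x∈⁅x⁆ b) ∷ [])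
    v∈X : v ∈ X
    v∈X = decidable-stable (v ∈? X) λ v∉X → ¬Tab (X , X-tight , v∉X , a∈X ∷ b∈X ∷ [])
    open MinimumTightSet simple independent a≢b Bab≡false X-tight a∈X b∈X
                         (λ Y-tight a∈Y b∈Y → X-minimum (Y-tight , a∈Y , b∈Y))

lemma3p6 : ∀ (n : ℕ) (B : Graph n) → Simple B → RBase B →
           ∀ (v : Fin n) → IsVertex B v → degree B v ≡ 3 →
           Σ (Fin n) λ a → Σ (Fin n) λ b →
             (¬ a ≡ b) × IsVertex B a × IsVertex B b × (B a b ≡ false) ×
             (¬ a ≡ v) × (¬ b ≡ v) ×
             (RDependent (addEdge B a b) ×
              (Σ (Graph n) λ C → FundamentalCircuit B a b C × IsVertex C v))
lemma3p6 n B simple base v v-vertex deg≡3 =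
  let x , y , z , xyz! , Bv = three-neighbours B v (≤-reflexive (sym deg≡3))
      a , b , a≢b , Bva , Bvb , ¬Tab =
        ¬TightAvoiding-neighbour-pair simple (RBase⇒RIndependent base) v-vertex xyz! Bv
      Bab≡false , C , C-fundamental , v∈C = fundamental-circuit-through simple base a≢b Bva Bvb ¬Tab
  in a , b , a≢b , neighbour-vertex simple Bva , neighbour-vertex simple Bvb , Bab≡false ,
     neighbour-≢ simple Bva , neighbour-≢ simple Bvb ,
     FundamentalCircuit⇒RDependent {B = B} {a} {b} C-fundamental , C , C-fundamental , v∈C
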